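{- For positive integers $k>n$, we have $a_{k,n}=F_{n+1}$.
   Context: $\mathbb{N}=\{1,2,3,\dots\}$, and $\mathcal{N}$ denotes the collection of finite subsets of $\mathbb{N}$. For $E\in\mathcal{N}$ and $k\in\mathbb{N}$, let $\omega_k(E)=\sum_{i\in E,\, i\neq k}1$. For $k,n\in\mathbb{N}$, let $\mathcal{A}_{k,n}=\{E\in\mathcal{N} : E=\emptyset \text{ or } \omega_k(E)<\min E\le \max E\le n\}$ and $a_{k,n}=|\mathcal{A}_{k,n}|$. $(F_n)_{n\ge0}$ is the Fibonacci sequence: $F_0=0$, $F_1=1$, $F_n=F_{n-1}+F_{n-2}$ for $n\ge2$. -}

module Defs where

open import Data.Nat using (ℕ; zero; suc; _+_; _<_; _≤_; _≟_; _<?_; _≤?_)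
open import Data.List using (List; []; _∷_; map; _++_; length; filter; foldr)
open import Data.Product using (_×_)
open import Data.Sum using (_⊎_)
open import Relation.Nullary using (Dec; yes; no; ¬_)
open import Relation.Nullary.Decidable using (_×-dec_; _⊎-dec_)
open import Relation.Binary.PropositionalEquality using (_≡_)

F : ℕ → ℕ
F zero = 0
F (suc zero) = 1
F (suc (suc n)) = F (suc n) + F n

-- A finite subset of ℕ = {1,2,...} is represented by the list of its
-- elements.  subsetsUpTo n enumerates every subset of {1,...,n} exactly
-- once (each listed without repetition).
subsetsUpTo : ℕ → List (List ℕ)
subsetsUpTo zero = [] ∷ []
subsetsUpTo (suc n) = subsetsUpTo n ++ map (suc n ∷_) (subsetsUpTo n)

ω : ℕ → List ℕ → ℕ
ω k [] = 0
ω k (i ∷ E) with i ≟ k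
... | yes _ = ω k E
... | no  _ = suc (ω k E)

-- min / max of a list (only used on nonempty lists; min [] = 0 is a dummy)
minL : List ℕ → ℕ
minL [] = 0
minL (x ∷ xs) = foldr Data.Nat._⊓_ x xs

maxL : List ℕ → ℕ
maxL [] = 0
maxL (x ∷ xs) = foldr Data.Nat._⊔_ x xs

InA : ℕ → ℕ → List ℕ → Set
InA k n [] = ⊤' where open import Data.Unit using () renaming (⊤ to ⊤')
InA k n E@(_ ∷ _) = (ω k E < minL E) × (minL E ≤ maxL E) × (maxL E ≤ n)

InA? : ∀ k n E → Dec (InA k n E)
InA? k n [] = yes _
InA? k n E@(_ ∷ _) = (ω k E <? minL E) ×-dec ((minL E ≤? maxL E) ×-dec (maxL E ≤? n))

-- a_{k,n} = |𝒜_{k,n}|.  Every member of 𝒜_{k,n} has max E ≤ n, hence is a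
-- subset of {1,...,n}; so it suffices to count among those.
a : ℕ → ℕ → ℕ
a k n = length (filter (InA? k n) (subsetsUpTo n))

-- A set E ⊆ {1,…,n} with n < k never contains k, so ω_k(E) = |E| and 𝒜_{k,n}
-- consists of the sets E ⊆ {1,…,n} with |E| < min E.  More generally, let
-- c(n, j) count the E ⊆ {1,…,n} with |E| + j < x for every x ∈ E.  The sets
-- E' ∪ {n+1} counted by c(n+1, j) are exactly those with E' counted by
-- c(n, j+1) when j < n, and there are none when n ≤ j.  Hence
-- c(n+1, j) = c(n, j) + c(n, j+1) for j < n and c(n+1, j) = c(n, j) otherwise,
-- which gives c(n, j) = F(n ∸ j + 1).
module Submission where

open import Defs
open import Data.Nat using (ℕ; zero; suc; _+_; _∸_; _<_; _≤_; _⊓_; _≟_; _<?_; z≤n; s≤s)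
open import Data.Nat.Properties
open import Data.List using (List; []; _∷_; map; _++_; length; filter)
open import Data.List.Properties using (filter-++; length-++; length-map; filter-none; foldr-preservesᵇ; foldr-preservesʳ; foldr-forcesᵇ)
open import Data.List.Relation.Unary.All as All using (All; []; _∷_; all?)
open import Data.List.Relation.Unary.All.Properties using (++⁺; map⁺)
open import Data.Product using (_×_; _,_)
open import Function using (_∘_; _⇔_; mk⇔; Equivalence)
open import Relation.Nullary using (yes; no; ¬_; contradiction)
open import Level using (Level; 0ℓ)
open import Relation.Unary using (Pred; Decidable)
open import Relation.Binary.PropositionalEquality using (_≡_; refl; sym; trans; cong; cong₂; subst; module ≡-Reasoning)

private
  variable
    ℓ p q : Level
    A B : Set ℓ

module _ {P : Pred B p} (P? : Decidable P) where

  filter-map : ∀ (f : A → B) xs → filter P? (map f xs) ≡ map f (filter (λ x → P? (f x)) xs)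
  filter-map f [] = refl
  filter-map f (x ∷ xs) with P? (f x)
  ... | yes _ = cong (f x ∷_) (filter-map f xs)
  ... | no  _ = filter-map f xs

module _ {P : Pred A p} {Q : Pred A q} (P? : Decidable P) (Q? : Decidable Q) where

  filter-≐-on : ∀ {xs} → All (λ x → P x ⇔ Q x) xs → filter P? xs ≡ filter Q? xs
  filter-≐-on [] = refl
  filter-≐-on {x ∷ _} (P⇔Q ∷ rest) with P? x | Q? x
  ... | yes _  | yes _  = cong (x ∷_) (filter-≐-on rest)
  ... | yes Px | no ¬Qx = contradiction (Equivalence.to P⇔Q Px) ¬Qx
  ... | no ¬Px | yes Qx = contradiction (Equivalence.from P⇔Q Qx) ¬Px
  ... | no _   | no _   = filter-≐-on rest

count : {P : Pred A p} → Decidable P → List A → ℕ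
count P? = length ∘ filter P?

count-subsetsUpTo-suc : ∀ {P : Pred (List ℕ) p} (P? : Decidable P) n →
  count P? (subsetsUpTo (suc n)) ≡ count P? (subsetsUpTo n) + count (λ E → P? (suc n ∷ E)) (subsetsUpTo n)
count-subsetsUpTo-suc P? n = begin
  length (filter P? (S ++ map (suc n ∷_) S))
    ≡⟨ cong length (filter-++ P? S _) ⟩
  length (filter P? S ++ filter P? (map (suc n ∷_) S))
    ≡⟨ length-++ (filter P? S) ⟩
  count P? S + length (filter P? (map (suc n ∷_) S))
    ≡⟨ cong (λ l → count P? S + length l) (filter-map P? (suc n ∷_) S) ⟩
  count P? S + length (map (suc n ∷_) (filter (λ E → P? (suc n ∷ E)) S))
    ≡⟨ cong (count P? S +_) (length-map (suc n ∷_) (filter (λ E → P? (suc n ∷ E)) S)) ⟩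
  count P? S + count (λ E → P? (suc n ∷ E)) S ∎
  where
  open ≡-Reasoning
  S = subsetsUpTo n

subsetsUpTo-bounded : ∀ n → All (All (_≤ n)) (subsetsUpTo n)
subsetsUpTo-bounded zero = [] ∷ []
subsetsUpTo-bounded (suc n) =
  ++⁺ (All.map (All.map m≤n⇒m≤1+n) (subsetsUpTo-bounded n))
      (map⁺ (All.map (λ E≤n → ≤-refl ∷ All.map m≤n⇒m≤1+n E≤n) (subsetsUpTo-bounded n)))

F-∸-step : ∀ {j n} → j < n → F (suc (n ∸ j)) + F (suc (n ∸ suc j)) ≡ F (suc (suc n ∸ j))
F-∸-step {j} {suc n} (s≤s j≤n) rewrite +-∸-assoc 1 (m≤n⇒m≤1+n j≤n) | +-∸-assoc 1 j≤n = refl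

F-∸-flat : ∀ {n j} → n ≤ j → F (suc (suc n ∸ j)) ≡ F (suc (n ∸ j))
F-∸-flat {j = zero} z≤n = refl
F-∸-flat {j = suc j} z≤n rewrite 0∸n≡0 j = refl
F-∸-flat (s≤s n≤j) = F-∸-flat n≤j

-- Vacuous for E = ∅, which absorbs the clause E = ∅ in the definition of 𝒜_{k,n}.
Sparse : ℕ → Pred (List ℕ) 0ℓ
Sparse j E = All (λ x → length E + j < x) E

sparse? : ∀ j → Decidable (Sparse j)
sparse? j E = all? (λ x → length E + j <? x) E

sparse-head : ∀ {j n E} → j < n → All (_≤ n) E → Sparse (suc j) E → length E + j < n
sparse-head j<n [] [] = j<n
sparse-head {j} {E = E} j<n (y≤n ∷ _) (E+j<y ∷ _) =
  <-trans (+-monoʳ-< (length E) (n<1+n j)) (<-≤-trans E+j<y y≤n)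

sparse-∷⇔ : ∀ {j n E} → j < n → All (_≤ n) E → Sparse j (suc n ∷ E) ⇔ Sparse (suc j) E
sparse-∷⇔ {j} {E = E} j<n E≤n = mk⇔
  (λ { (_ ∷ tail) → subst (λ t → All (t <_) E) (sym (+-suc (length E) j)) tail })
  (λ sparse → s≤s (sparse-head j<n E≤n sparse) ∷ subst (λ t → All (t <_) E) (+-suc (length E) j) sparse)

not-sparse-∷ : ∀ {j n} E → n ≤ j → ¬ Sparse j (suc n ∷ E)
not-sparse-∷ {j} E n≤j (s≤s E+j<n ∷ _) = <-irrefl refl (<-≤-trans E+j<n (≤-trans n≤j (m≤n+m j (length E))))

count-sparse-∷ : ∀ {j n} → j < n →
  count (λ E → sparse? j (suc n ∷ E)) (subsetsUpTo n) ≡ count (sparse? (suc j)) (subsetsUpTo n)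
count-sparse-∷ {j} {n} j<n =
  cong length (filter-≐-on _ (sparse? (suc j)) (All.map (sparse-∷⇔ j<n) (subsetsUpTo-bounded n)))

count-not-sparse-∷ : ∀ {j n} → n ≤ j → count (λ E → sparse? j (suc n ∷ E)) (subsetsUpTo n) ≡ 0
count-not-sparse-∷ {j} {n} n≤j =
  cong length (filter-none (λ E → sparse? j (suc n ∷ E)) {subsetsUpTo n}
                           (All.tabulate (λ {E} _ → not-sparse-∷ E n≤j)))

count-sparse : ∀ n j → count (sparse? j) (subsetsUpTo n) ≡ F (suc (n ∸ j))
count-sparse zero j rewrite 0∸n≡0 j = refl
count-sparse (suc n) j with j <? n
... | yes j<n = begin
  count (sparse? j) (subsetsUpTo (suc n))
    ≡⟨ count-subsetsUpTo-suc (sparse? j) n ⟩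
  count (sparse? j) (subsetsUpTo n) + count (λ E → sparse? j (suc n ∷ E)) (subsetsUpTo n)
    ≡⟨ cong (count (sparse? j) (subsetsUpTo n) +_) (count-sparse-∷ j<n) ⟩
  count (sparse? j) (subsetsUpTo n) + count (sparse? (suc j)) (subsetsUpTo n)
    ≡⟨ cong₂ _+_ (count-sparse n j) (count-sparse n (suc j)) ⟩
  F (suc (n ∸ j)) + F (suc (n ∸ suc j))
    ≡⟨ F-∸-step j<n ⟩
  F (suc (suc n ∸ j)) ∎
  where open ≡-Reasoning
... | no j≮n = begin
  count (sparse? j) (subsetsUpTo (suc n))
    ≡⟨ count-subsetsUpTo-suc (sparse? j) n ⟩
  count (sparse? j) (subsetsUpTo n) + count (λ E → sparse? j (suc n ∷ E)) (subsetsUpTo n)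
    ≡⟨ cong₂ _+_ (count-sparse n j) (count-not-sparse-∷ (≮⇒≥ j≮n)) ⟩
  F (suc (n ∸ j)) + 0
    ≡⟨ +-identityʳ _ ⟩
  F (suc (n ∸ j))
    ≡⟨ sym (F-∸-flat (≮⇒≥ j≮n)) ⟩
  F (suc (suc n ∸ j)) ∎
  where open ≡-Reasoning

ω≡length : ∀ {k} E → All (_< k) E → ω k E ≡ length E
ω≡length [] [] = refl
ω≡length {k} (i ∷ E) (i<k ∷ E<k) with i ≟ k
... | yes refl = contradiction i<k (<-irrefl refl)
... | no  _    = cong suc (ω≡length E E<k)

minL≤head : ∀ x xs → minL (x ∷ xs) ≤ x
minL≤head x = foldr-preservesʳ {P = _≤ x} (λ y min≤x → ≤-trans (m⊓n≤n y _) min≤x) ≤-refl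

head≤maxL : ∀ x xs → x ≤ maxL (x ∷ xs)
head≤maxL x = foldr-preservesʳ {P = x ≤_} (λ y x≤max → ≤-trans x≤max (m≤n⊔m y _)) ≤-refl

<-minL⇔ : ∀ {m} x xs → m < minL (x ∷ xs) ⇔ All (m <_) (x ∷ xs)
<-minL⇔ {m} x xs = mk⇔
  (λ m<min → <-≤-trans m<min (minL≤head x xs) ∷ foldr-forcesᵇ {P = m <_} splitMin x xs m<min)
  (λ { (m<x ∷ m<xs) → foldr-preservesᵇ {P = m <_} ⊓-glb m<x m<xs })
  where
  splitMin : ∀ y z → m < y ⊓ z → m < y × m < z
  splitMin y z m<y⊓z = m<n⊓o⇒m<n y z m<y⊓z , m<n⊓o⇒m<o y z m<y⊓z

maxL≤ : ∀ {n} x xs → All (_≤ n) (x ∷ xs) → maxL (x ∷ xs) ≤ n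
maxL≤ {n} x xs (x≤n ∷ xs≤n) = foldr-preservesᵇ {P = _≤ n} ⊔-lub x≤n xs≤n

inA⇔sparse : ∀ {k n E} → n < k → All (_≤ n) E → InA k n E ⇔ Sparse 0 E
inA⇔sparse {E = []} _ _ = mk⇔ (λ _ → []) (λ _ → _)
inA⇔sparse {k} {n} {E@(x ∷ xs)} n<k E≤n = mk⇔
  (λ { (ω<min , _ , _) → Equivalence.to (<-minL⇔ x xs) (subst (_< minL E) ωE ω<min) })
  (λ sparse → subst (_< minL E) (sym ωE) (Equivalence.from (<-minL⇔ x xs) sparse)
             , ≤-trans (minL≤head x xs) (head≤maxL x xs)
             , maxL≤ x xs E≤n)
  where
  ωE : ω k E ≡ length E + 0
  ωE = trans (ω≡length E (All.map (λ i≤n → ≤-<-trans i≤n n<k) E≤n)) (sym (+-identityʳ _))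

proposition3p1 : (k n : ℕ) → 0 < n → n < k → a k n ≡ F (suc n)
proposition3p1 k n _ n<k = begin
  a k n
    ≡⟨ cong length (filter-≐-on (InA? k n) (sparse? 0) (All.map (inA⇔sparse n<k) (subsetsUpTo-bounded n))) ⟩
  count (sparse? 0) (subsetsUpTo n)
    ≡⟨ count-sparse n 0 ⟩
  F (suc n) ∎
  where open ≡-Reasoning
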